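{- Let $i\in\mathbb Z$, $a\in\mathbb A_i$ and $x\in\mathcal L_i$. (1) If $Z$ is an internal predicate then $Z[a\mapsto x]$ is well-defined, $\mathrm{minlev}(Z[a\mapsto x])\ge\mathrm{minlev}(Z,a,x)$, and $Z[a\mapsto x]$ is an internal predicate. (2) If $k\in\mathbb Z$ and $z\in\mathcal L_k$ then $z[a\mapsto x]$ is well-defined, $\mathrm{minlev}(z[a\mapsto x])\ge\mathrm{minlev}(z,a,x)$, and $z[a\mapsto x]\in\mathcal L_k$.
   Context: Atoms: for each $i\in\mathbb Z$ a set $\mathbb A_i$ of atoms (pairwise disjoint, each of cardinality $\beth_\omega$); $\mathrm{level}(a)=i$ iff $a\in\mathbb A_i$. Distinct letters $a,b,c,\dots$ denote distinct atoms; $n$ denotes an arbitrary atom. $(a\,b)$ swaps two atoms of equal level. Internal syntax (nominal abstract syntax, binders $[a]$ up to $\alpha$-equivalence), built inductively: internal predicates are $\wedge(\mathcal X)$ for a finite set $\mathcal X$ of internal predicates, $\neg X$, $\forall[a]X$ (any atom $a$, binding), and $\in(x,a)$ with $a\in\mathbb A_{i+1}$, $x\in\mathcal L_i$; internal sets of level $i$ ($\mathcal L_i$) are $\mathrm{atm}(a)$ for $a\in\mathbb A_i$ and $[a]X$ for $a\in\mathbb A_{i-1}$ and $X$ an internal predicate. $a\#Z$ means $a$ is not free in $Z$. The substitution ($\sigma$-action) $Z[a\mapsto x]$, for $a\in\mathbb A_i$ and $x\in\mathcal L_i$, is specified by the recursive equations: $\wedge(\mathcal X)[a\mapsto x]=\wedge(\{X[a\mapsto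 x]:X\in\mathcal X\})$; $\neg(X)[a\mapsto x]=\neg(X[a\mapsto x])$; $(\forall[b]X)[a\mapsto x]=\forall[b](X[a\mapsto x])$ if $b\#x$; $\in(y,a)[a\mapsto\mathrm{atm}(n)]=\in(y[a\mapsto\mathrm{atm}(n)],n)$ for any $n\in\mathbb A_i$; $\in(y,a)[a\mapsto[a']X]=X[a'\mapsto y[a\mapsto[a']X]]$ where $a'\in\mathbb A_{i-1}$ is fresh; $\in(y,b)[a\mapsto x]=\in(y[a\mapsto x],b)$; $\mathrm{atm}(a)[a\mapsto x]=x$; $\mathrm{atm}(b)[a\mapsto x]=\mathrm{atm}(b)$; $([c]X)[a\mapsto x]=[c](X[a\mapsto x])$ if $c\#x$. "Well-defined" means these equations determine a unique value (in particular independent of the choice of fresh atoms). Minimum level: $\mathrm{minlev}(\mathrm{atm}(a))=\mathrm{level}(a)$; $\mathrm{minlev}(\wedge(\mathcal X))=\min(\{0\}\cup\{\mathrm{minlev}(X):X\in\mathcal X\})$; $\mathrm{minlev}(\neg X)=\mathrm{minlev}(X)$; $\mathrm{minlev}(\forall[a]X)=\min(\mathrm{level}(a),\mathrm{minlev}(X))$; $\mathrm{minlev}(\in(x,a))=\min(\mathrm{minlev}(x),\mathrm{level}(a))$; $\mathrm{minlev}([a]X)=\min(\mathrm{level}(a),\mathrm{minlev}(X))$. For an atom, $\mathrm{minlev}(a)=\mathrm{level}(a)$, and for a list of internal predicates, internal sets and atoms, $\mathrm{minlev}$ of the list is the least $\mathrm{minlev}$ of its entries. -}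

module Defs where

open import Data.Integer using (ℤ; _-_; _⊓_; 0ℤ; 1ℤ)
open import Data.Nat using (ℕ)
open import Data.Product using (_×_; _,_; ∃-syntax; proj₁; proj₂)
open import Data.Sum using (_⊎_)
open import Data.List using (List; []; _∷_)
open import Data.List.Relation.Unary.All using (All)
open import Data.List.Relation.Unary.Any using (Any)
open import Data.List.Relation.Binary.Pointwise using (Pointwise)
open import Relation.Binary.PropositionalEquality using (_≡_; _≢_)
open import Relation.Nullary using (¬_; yes; no)
import Data.Integer.Properties as ℤP
import Data.Nat.Properties as ℕP

Atom : Set
Atom = ℤ × ℕ

level : Atom → ℤ
level = proj₁

_≟A_ : (a b : Atom) → Relation.Nullary.Dec (a ≡ b)
(i , n) ≟A (j , m) with i ℤP.≟ j | n ℕP.≟ m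
... | yes Relation.Binary.PropositionalEquality.refl | yes Relation.Binary.PropositionalEquality.refl = yes Relation.Binary.PropositionalEquality.refl
... | no p | _ = no λ { Relation.Binary.PropositionalEquality.refl → p Relation.Binary.PropositionalEquality.refl }
... | yes _ | no q = no λ { Relation.Binary.PropositionalEquality.refl → q Relation.Binary.PropositionalEquality.refl }

-- Raw internal syntax (before quotienting by α-equivalence).
--   and Xs  = ∧(𝒳)   (finite set represented by a list)
--   neg X   = ¬X
--   all a X = ∀[a]X
--   mem x a = ∈(x,a)
--   atm a   = atm(a)
--   lam a X = [a]X

mutual
  data Pred : Set where
    and : List Pred → Pred
    neg : Pred → Pred
    all : Atom → Pred → Pred
    mem : St → Atom → Pred

  data St : Set where
    atm : Atom → St
    lam : Atom → Pred → St

swapA : Atom → Atom → Atom → Atom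
swapA a b c with c ≟A a
... | yes _ = b
... | no _ with c ≟A b
...   | yes _ = a
...   | no _ = c

mutual
  swapP : Atom → Atom → Pred → Pred
  swapP a b (and Xs) = and (swapPs a b Xs)
  swapP a b (neg X) = neg (swapP a b X)
  swapP a b (all c X) = all (swapA a b c) (swapP a b X)
  swapP a b (mem x c) = mem (swapS a b x) (swapA a b c)

  swapPs : Atom → Atom → List Pred → List Pred
  swapPs a b [] = []
  swapPs a b (X ∷ Xs) = swapP a b X ∷ swapPs a b Xs

  swapS : Atom → Atom → St → St
  swapS a b (atm c) = atm (swapA a b c)
  swapS a b (lam c X) = lam (swapA a b c) (swapP a b X)

mutual
  data FreeP (a : Atom) : Pred → Set where
    f-and : ∀ {Xs} → Any (FreeP a) Xs → FreeP a (and Xs)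
    f-neg : ∀ {X} → FreeP a X → FreeP a (neg X)
    f-all : ∀ {b X} → b ≢ a → FreeP a X → FreeP a (all b X)
    f-mem₁ : ∀ {x b} → FreeS a x → FreeP a (mem x b)
    f-mem₂ : ∀ {x} → FreeP a (mem x a)

  data FreeS (a : Atom) : St → Set where
    f-atm : FreeS a (atm a)
    f-lam : ∀ {c X} → c ≢ a → FreeP a X → FreeS a (lam c X)

_#P_ : Atom → Pred → Set
a #P Z = ¬ FreeP a Z

_#S_ : Atom → St → Set
a #S z = ¬ FreeS a z

-- α-equivalence (nominal style: ∀[a]X ≈ ∀[b]Y iff for some c of the same
-- level, fresh for both abstractions, (c a)·X ≈ (c b)·Y).
-- ∧(𝒳) is a finite *set*: two conjunctions are equivalent when every
-- conjunct of each is equivalent to some conjunct of the other.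

mutual
  data _≈P_ : Pred → Pred → Set where
    ≈-and : ∀ {Xs Ys} → All (λ X → Any (X ≈P_) Ys) Xs → All (λ Y → Any (_≈P Y) Xs) Ys →
            and Xs ≈P and Ys
    ≈-neg : ∀ {X Y} → X ≈P Y → neg X ≈P neg Y
    ≈-all : ∀ {a b X Y} c → level a ≡ level b → level c ≡ level a →
            c #P all a X → c #P all b Y → swapP c a X ≈P swapP c b Y → all a X ≈P all b Y
    ≈-mem : ∀ {x y a} → x ≈S y → mem x a ≈P mem y a

  data _≈S_ : St → St → Set where
    ≈-atm : ∀ {a} → atm a ≈S atm a
    ≈-lam : ∀ {a b X Y} c → level a ≡ level b → level c ≡ level a →
            c #S lam a X → c #S lam b Y → swapP c a X ≈P swapP c b Y → lam a X ≈S lam b Y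

mutual
  data IsPred : Pred → Set where
    wf-and : ∀ {Xs} → All IsPred Xs → IsPred (and Xs)
    wf-neg : ∀ {X} → IsPred X → IsPred (neg X)
    wf-all : ∀ {a X} → IsPred X → IsPred (all a X)
    wf-mem : ∀ {x a} → IsSet (level a - 1ℤ) x → IsPred (mem x a)

  data IsSet : ℤ → St → Set where
    wf-atm : ∀ {a} → IsSet (level a) (atm a)
    wf-lam : ∀ {k a X} → level a ≡ k - 1ℤ → IsPred X → IsSet k (lam a X)

mutual
  minlevP : Pred → ℤ
  minlevP (and Xs) = minlevPs Xs
  minlevP (neg X) = minlevP X
  minlevP (all a X) = level a ⊓ minlevP X
  minlevP (mem x a) = minlevS x ⊓ level a

  minlevPs : List Pred → ℤ
  minlevPs [] = 0ℤ
  minlevPs (X ∷ Xs) = minlevP X ⊓ minlevPs Xs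

  minlevS : St → ℤ
  minlevS (atm a) = level a
  minlevS (lam a X) = level a ⊓ minlevP X

-- The σ-action Z[a ↦ x], given as the graph of the recursive equations.
-- SubP a x Z R  means "R is a value of Z[a ↦ x] according to the equations";
-- the relation is taken on α-equivalence classes, i.e. closed under α on
-- the input Z, the parameter x and the output R.  Distinct letters denote
-- distinct atoms, which gives the side conditions b ≢ a.

mutual
  data SubP (a : Atom) (x : St) : Pred → Pred → Set where
    s-α : ∀ {x' Z Z' R R'} → x ≈S x' → Z ≈P Z' → SubP a x' Z' R' → R' ≈P R → SubP a x Z R
    s-and : ∀ {Xs Rs} → Pointwise (SubP a x) Xs Rs → SubP a x (and Xs) (and Rs)
    s-neg : ∀ {X R} → SubP a x X R → SubP a x (neg X) (neg R)
    s-all : ∀ {b X R} → b ≢ a → b #S x → SubP a x X R → SubP a x (all b X) (all b R)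
    s-mem-atm : ∀ {y y' n} → x ≡ atm n → SubS a x y y' → SubP a x (mem y a) (mem y' n)
    -- ∈(y,a)[a ↦ [a']X] = X[a' ↦ y[a ↦ [a']X]],  a' fresh
    s-mem-lam : ∀ {y y' a' X R} → x ≡ lam a' X → a' ≢ a → a' #S y → a' #S y' →
                SubS a x y y' → SubP a' y' X R → SubP a x (mem y a) R
    s-mem : ∀ {y y' b} → b ≢ a → SubS a x y y' → SubP a x (mem y b) (mem y' b)

  data SubS (a : Atom) (x : St) : St → St → Set where
    s-α : ∀ {x' z z' r r'} → x ≈S x' → z ≈S z' → SubS a x' z' r' → r' ≈S r → SubS a x z r
    s-atm-a : SubS a x (atm a) x
    s-atm-b : ∀ {b} → b ≢ a → SubS a x (atm b) (atm b)
    s-lam : ∀ {c X R} → c ≢ a → c #S x → SubP a x X R → SubS a x (lam c X) (lam c R)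

-- Defs gives the σ-action as a relation closed under α, so well-definedness
-- is existence plus uniqueness.  The σ-action is
-- equivariant and creates no free atoms; uniqueness follows by recursion on
-- derivation depth, renaming binders to a common fresh atom.  Existence with
-- the minlev bound recurses on a level budget -- unfolding ∈(y,a)[a ↦ [a']X]
-- substitutes for an atom one level lower, and levels never drop below the
-- bound -- and then on the well-formedness derivation of Z.

module Submission where

open import Defs
open import Data.Integer using (ℤ; _⊓_; _≤_)
open import Data.Product using (_×_; ∃-syntax)
open import Relation.Binary.PropositionalEquality using (_≡_)

open import Data.Integer using (_+_; _-_; +_; -_; 1ℤ; 0ℤ; ∣_∣)
import Data.Integer.Properties as ℤP
open import Data.Integer.Tactic.RingSolver using (solve-∀)
open import Data.Nat as ℕ using (ℕ; zero; suc; _⊔_; s≤s)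
import Data.Nat.Properties as ℕP
open import Data.Product as Product using (Σ; _,_; proj₂)
open import Data.Sum as Sum using (_⊎_; inj₁; inj₂)
open import Data.Empty using (⊥; ⊥-elim)
open import Data.List using (List; []; _∷_)
open import Data.List.Relation.Unary.All as All using (All; []; _∷_)
open import Data.List.Relation.Unary.Any as Any using (Any; here; there)
open import Data.List.Relation.Binary.Pointwise using (Pointwise; []; _∷_)
open import Data.List.Membership.Propositional using (_∈_)
open import Relation.Binary.PropositionalEquality using (refl; sym; trans; cong; cong₂; subst; subst₂; _≢_)
open import Relation.Nullary using (¬_; yes; no; Dec)

swapA-left : ∀ a b → swapA a b a ≡ b
swapA-left a b with a ≟A a
... | yes _ = refl
... | no a≢a = ⊥-elim (a≢a refl)

swapA-right : ∀ a b → swapA a b b ≡ a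
swapA-right a b with b ≟A a
... | yes b≡a = b≡a
... | no _ with b ≟A b
...   | yes _ = refl
...   | no b≢b = ⊥-elim (b≢b refl)

swapA-other : ∀ {a b c} → c ≢ a → c ≢ b → swapA a b c ≡ c
swapA-other {a} {b} {c} c≢a c≢b with c ≟A a
... | yes c≡a = ⊥-elim (c≢a c≡a)
... | no _ with c ≟A b
...   | yes c≡b = ⊥-elim (c≢b c≡b)
...   | no _ = refl

data SwapCase (a b c : Atom) : Set where
  left : c ≡ a → SwapCase a b c
  right : c ≡ b → SwapCase a b c
  other : c ≢ a → c ≢ b → SwapCase a b c

swapCase : ∀ a b c → SwapCase a b c
swapCase a b c with c ≟A a
... | yes c≡a = left c≡a
... | no c≢a with c ≟A b
...   | yes c≡b = right c≡b
...   | no c≢b = other c≢a c≢b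

swapA-involutive : ∀ a b c → swapA a b (swapA a b c) ≡ c
swapA-involutive a b c with swapCase a b c
... | left refl rewrite swapA-left c b = swapA-right c b
... | right refl rewrite swapA-right a c = swapA-left a c
... | other c≢a c≢b rewrite swapA-other c≢a c≢b = swapA-other c≢a c≢b

swapA-injective : ∀ a b {c d} → swapA a b c ≡ swapA a b d → c ≡ d
swapA-injective a b {c} {d} eq =
  trans (sym (swapA-involutive a b c)) (trans (cong (swapA a b) eq) (swapA-involutive a b d))

swapA-comm : ∀ a b c → swapA a b c ≡ swapA b a c
swapA-comm a b c with swapCase a b c
... | left refl = trans (swapA-left c b) (sym (swapA-right b c))
... | right refl = trans (swapA-right a c) (sym (swapA-left c a))
... | other c≢a c≢b = trans (swapA-other c≢a c≢b) (sym (swapA-other c≢b c≢a))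

swapA-self : ∀ a c → swapA a a c ≡ c
swapA-self a c with swapCase a a c
... | left refl = swapA-left c c
... | right refl = swapA-left c c
... | other c≢a _ = swapA-other c≢a c≢a

swapA-conjugate : ∀ p q a b c →
  swapA p q (swapA a b c) ≡ swapA (swapA p q a) (swapA p q b) (swapA p q c)
swapA-conjugate p q a b c with swapCase a b c
... | left refl rewrite swapA-left c b = sym (swapA-left (swapA p q c) (swapA p q b))
... | right refl rewrite swapA-right a c = sym (swapA-right (swapA p q a) (swapA p q c))
... | other c≢a c≢b rewrite swapA-other c≢a c≢b =
  sym (swapA-other (λ eq → c≢a (swapA-injective p q eq)) (λ eq → c≢b (swapA-injective p q eq)))

swapA-level : ∀ {p q} c → level p ≡ level q → level (swapA p q c) ≡ level c
swapA-level {p} {q} c lp≡lq with swapCase p q c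
... | left refl rewrite swapA-left c q = sym lp≡lq
... | right refl rewrite swapA-right p c = lp≡lq
... | other c≢p c≢q rewrite swapA-other c≢p c≢q = refl

mutual
  swapP-involutive : ∀ a b X → swapP a b (swapP a b X) ≡ X
  swapP-involutive a b (and Xs) = cong and (swapPs-involutive a b Xs)
  swapP-involutive a b (neg X) = cong neg (swapP-involutive a b X)
  swapP-involutive a b (all c X) = cong₂ all (swapA-involutive a b c) (swapP-involutive a b X)
  swapP-involutive a b (mem x c) = cong₂ mem (swapS-involutive a b x) (swapA-involutive a b c)

  swapPs-involutive : ∀ a b Xs → swapPs a b (swapPs a b Xs) ≡ Xs
  swapPs-involutive a b [] = refl
  swapPs-involutive a b (X ∷ Xs) = cong₂ _∷_ (swapP-involutive a b X) (swapPs-involutive a b Xs)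

  swapS-involutive : ∀ a b x → swapS a b (swapS a b x) ≡ x
  swapS-involutive a b (atm c) = cong atm (swapA-involutive a b c)
  swapS-involutive a b (lam c X) = cong₂ lam (swapA-involutive a b c) (swapP-involutive a b X)

mutual
  swapP-comm : ∀ a b X → swapP a b X ≡ swapP b a X
  swapP-comm a b (and Xs) = cong and (swapPs-comm a b Xs)
  swapP-comm a b (neg X) = cong neg (swapP-comm a b X)
  swapP-comm a b (all c X) = cong₂ all (swapA-comm a b c) (swapP-comm a b X)
  swapP-comm a b (mem x c) = cong₂ mem (swapS-comm a b x) (swapA-comm a b c)

  swapPs-comm : ∀ a b Xs → swapPs a b Xs ≡ swapPs b a Xs
  swapPs-comm a b [] = refl
  swapPs-comm a b (X ∷ Xs) = cong₂ _∷_ (swapP-comm a b X) (swapPs-comm a b Xs)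

  swapS-comm : ∀ a b x → swapS a b x ≡ swapS b a x
  swapS-comm a b (atm c) = cong atm (swapA-comm a b c)
  swapS-comm a b (lam c X) = cong₂ lam (swapA-comm a b c) (swapP-comm a b X)

mutual
  swapP-self : ∀ a X → swapP a a X ≡ X
  swapP-self a (and Xs) = cong and (swapPs-self a Xs)
  swapP-self a (neg X) = cong neg (swapP-self a X)
  swapP-self a (all c X) = cong₂ all (swapA-self a c) (swapP-self a X)
  swapP-self a (mem x c) = cong₂ mem (swapS-self a x) (swapA-self a c)

  swapPs-self : ∀ a Xs → swapPs a a Xs ≡ Xs
  swapPs-self a [] = refl
  swapPs-self a (X ∷ Xs) = cong₂ _∷_ (swapP-self a X) (swapPs-self a Xs)

  swapS-self : ∀ a x → swapS a a x ≡ x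
  swapS-self a (atm c) = cong atm (swapA-self a c)
  swapS-self a (lam c X) = cong₂ lam (swapA-self a c) (swapP-self a X)

mutual
  swapP-conjugate : ∀ p q a b X →
    swapP p q (swapP a b X) ≡ swapP (swapA p q a) (swapA p q b) (swapP p q X)
  swapP-conjugate p q a b (and Xs) = cong and (swapPs-conjugate p q a b Xs)
  swapP-conjugate p q a b (neg X) = cong neg (swapP-conjugate p q a b X)
  swapP-conjugate p q a b (all c X) =
    cong₂ all (swapA-conjugate p q a b c) (swapP-conjugate p q a b X)
  swapP-conjugate p q a b (mem x c) =
    cong₂ mem (swapS-conjugate p q a b x) (swapA-conjugate p q a b c)

  swapPs-conjugate : ∀ p q a b Xs →
    swapPs p q (swapPs a b Xs) ≡ swapPs (swapA p q a) (swapA p q b) (swapPs p q Xs)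
  swapPs-conjugate p q a b [] = refl
  swapPs-conjugate p q a b (X ∷ Xs) =
    cong₂ _∷_ (swapP-conjugate p q a b X) (swapPs-conjugate p q a b Xs)

  swapS-conjugate : ∀ p q a b x →
    swapS p q (swapS a b x) ≡ swapS (swapA p q a) (swapA p q b) (swapS p q x)
  swapS-conjugate p q a b (atm c) = cong atm (swapA-conjugate p q a b c)
  swapS-conjugate p q a b (lam c X) =
    cong₂ lam (swapA-conjugate p q a b c) (swapP-conjugate p q a b X)

swap-≢ : ∀ p q {b c} → b ≢ c → swapA p q b ≢ swapA p q c
swap-≢ p q b≢c eq = b≢c (swapA-injective p q eq)

mutual
  free-swapP : ∀ p q {c X} → FreeP c X → FreeP (swapA p q c) (swapP p q X)
  free-swapP p q (f-and any) = f-and (free-swapPs p q any)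
  free-swapP p q (f-neg f) = f-neg (free-swapP p q f)
  free-swapP p q (f-all b≢c f) = f-all (swap-≢ p q b≢c) (free-swapP p q f)
  free-swapP p q (f-mem₁ f) = f-mem₁ (free-swapS p q f)
  free-swapP p q f-mem₂ = f-mem₂

  free-swapPs : ∀ p q {c Xs} → Any (FreeP c) Xs → Any (FreeP (swapA p q c)) (swapPs p q Xs)
  free-swapPs p q (here f) = here (free-swapP p q f)
  free-swapPs p q (there any) = there (free-swapPs p q any)

  free-swapS : ∀ p q {c x} → FreeS c x → FreeS (swapA p q c) (swapS p q x)
  free-swapS p q f-atm = f-atm
  free-swapS p q (f-lam b≢c f) = f-lam (swap-≢ p q b≢c) (free-swapP p q f)

fresh-swapP : ∀ p q {c X} → c #P X → swapA p q c #P swapP p q X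
fresh-swapP p q {c} {X} c#X f =
  c#X (subst₂ FreeP (swapA-involutive p q c) (swapP-involutive p q X) (free-swapP p q f))

fresh-swapS : ∀ p q {c x} → c #S x → swapA p q c #S swapS p q x
fresh-swapS p q {c} {x} c#x f =
  c#x (subst₂ FreeS (swapA-involutive p q c) (swapS-involutive p q x) (free-swapS p q f))

mutual
  minlev-swapP : ∀ {p q} → level p ≡ level q → ∀ X → minlevP (swapP p q X) ≡ minlevP X
  minlev-swapP e (and Xs) = minlev-swapPs e Xs
  minlev-swapP e (neg X) = minlev-swapP e X
  minlev-swapP e (all a X) = cong₂ _⊓_ (swapA-level a e) (minlev-swapP e X)
  minlev-swapP e (mem x a) = cong₂ _⊓_ (minlev-swapS e x) (swapA-level a e)

  minlev-swapPs : ∀ {p q} → level p ≡ level q → ∀ Xs → minlevPs (swapPs p q Xs) ≡ minlevPs Xs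
  minlev-swapPs e [] = refl
  minlev-swapPs e (X ∷ Xs) = cong₂ _⊓_ (minlev-swapP e X) (minlev-swapPs e Xs)

  minlev-swapS : ∀ {p q} → level p ≡ level q → ∀ x → minlevS (swapS p q x) ≡ minlevS x
  minlev-swapS e (atm a) = swapA-level a e
  minlev-swapS e (lam a X) = cong₂ _⊓_ (swapA-level a e) (minlev-swapP e X)

mutual
  wf-swapP : ∀ {p q} → level p ≡ level q → ∀ {X} → IsPred X → IsPred (swapP p q X)
  wf-swapP e (wf-and ws) = wf-and (wf-swapPs e ws)
  wf-swapP e (wf-neg w) = wf-neg (wf-swapP e w)
  wf-swapP e (wf-all w) = wf-all (wf-swapP e w)
  wf-swapP {p} {q} e (wf-mem {x} {a} w) =
    wf-mem (subst (λ l → IsSet (l - 1ℤ) (swapS p q x))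
                  (sym (swapA-level a e)) (wf-swapS e w))

  wf-swapPs : ∀ {p q} → level p ≡ level q → ∀ {Xs} → All IsPred Xs → All IsPred (swapPs p q Xs)
  wf-swapPs e [] = []
  wf-swapPs e (w ∷ ws) = wf-swapP e w ∷ wf-swapPs e ws

  wf-swapS : ∀ {p q} → level p ≡ level q → ∀ {k x} → IsSet k x → IsSet k (swapS p q x)
  wf-swapS {p} {q} e (wf-atm {a}) = subst (λ k → IsSet k (atm (swapA p q a))) (swapA-level a e) wf-atm
  wf-swapS e (wf-lam {a = a} l w) = wf-lam (trans (swapA-level a e) l) (wf-swapP e w)

-- Syntactic size; transitivity of α-equivalence is proved by recursion on it.

mutual
  sizeP : Pred → ℕ
  sizeP (and Xs) = suc (sizePs Xs)
  sizeP (neg X) = suc (sizeP X)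
  sizeP (all a X) = suc (sizeP X)
  sizeP (mem x a) = suc (sizeS x)

  sizePs : List Pred → ℕ
  sizePs [] = 0
  sizePs (X ∷ Xs) = sizeP X ℕ.+ sizePs Xs

  sizeS : St → ℕ
  sizeS (atm a) = 1
  sizeS (lam a X) = suc (sizeP X)

mutual
  size-swapP : ∀ p q X → sizeP (swapP p q X) ≡ sizeP X
  size-swapP p q (and Xs) = cong suc (size-swapPs p q Xs)
  size-swapP p q (neg X) = cong suc (size-swapP p q X)
  size-swapP p q (all a X) = cong suc (size-swapP p q X)
  size-swapP p q (mem x a) = cong suc (size-swapS p q x)

  size-swapPs : ∀ p q Xs → sizePs (swapPs p q Xs) ≡ sizePs Xs
  size-swapPs p q [] = refl
  size-swapPs p q (X ∷ Xs) = cong₂ ℕ._+_ (size-swapP p q X) (size-swapPs p q Xs)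

  size-swapS : ∀ p q x → sizeS (swapS p q x) ≡ sizeS x
  size-swapS p q (atm a) = refl
  size-swapS p q (lam a X) = cong suc (size-swapP p q X)

-- Every atom occurring free in a term has a name (second
-- component) bounded by the largest name in the term, so the successor of
-- the largest name occurring in a finite list of objects is fresh for all of
-- them, at any prescribed level.

mutual
  namesP : Pred → ℕ
  namesP (and Xs) = namesPs Xs
  namesP (neg X) = namesP X
  namesP (all a X) = proj₂ a ⊔ namesP X
  namesP (mem x a) = namesS x ⊔ proj₂ a

  namesPs : List Pred → ℕ
  namesPs [] = 0
  namesPs (X ∷ Xs) = namesP X ⊔ namesPs Xs

  namesS : St → ℕ
  namesS (atm a) = proj₂ a
  namesS (lam a X) = proj₂ a ⊔ namesP X

mutual
  free≤namesP : ∀ {c X} → FreeP c X → proj₂ c ℕ.≤ namesP X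
  free≤namesP (f-and any) = free≤namesPs any
  free≤namesP {X = all a X} (f-all _ f) = ℕP.≤-trans (free≤namesP f) (ℕP.m≤n⊔m (proj₂ a) (namesP X))
  free≤namesP (f-neg f) = free≤namesP f
  free≤namesP {X = mem x a} (f-mem₁ f) = ℕP.≤-trans (free≤namesS f) (ℕP.m≤m⊔n (namesS x) (proj₂ a))
  free≤namesP {X = mem x a} f-mem₂ = ℕP.m≤n⊔m (namesS x) (proj₂ a)

  free≤namesPs : ∀ {c Xs} → Any (FreeP c) Xs → proj₂ c ℕ.≤ namesPs Xs
  free≤namesPs {Xs = X ∷ Xs} (here f) = ℕP.≤-trans (free≤namesP f) (ℕP.m≤m⊔n (namesP X) (namesPs Xs))
  free≤namesPs {Xs = X ∷ Xs} (there any) = ℕP.≤-trans (free≤namesPs any) (ℕP.m≤n⊔m (namesP X) (namesPs Xs))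

  free≤namesS : ∀ {c x} → FreeS c x → proj₂ c ℕ.≤ namesS x
  free≤namesS f-atm = ℕP.≤-refl
  free≤namesS {x = lam a X} (f-lam _ f) = ℕP.≤-trans (free≤namesP f) (ℕP.m≤n⊔m (proj₂ a) (namesP X))

-- The objects a fresh atom has to avoid.
data Obj : Set where
  pred : Pred → Obj
  set : St → Obj
  atom : Atom → Obj

namesO : Obj → ℕ
namesO (pred X) = namesP X
namesO (set x) = namesS x
namesO (atom a) = proj₂ a

namesL : List Obj → ℕ
namesL [] = 0
namesL (o ∷ os) = namesO o ⊔ namesL os

∈⇒≤namesL : ∀ {o os} → o ∈ os → namesO o ℕ.≤ namesL os
∈⇒≤namesL {o} {_ ∷ os} (here refl) = ℕP.m≤m⊔n (namesO o) (namesL os)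
∈⇒≤namesL {o} {o' ∷ os} (there o∈os) = ℕP.≤-trans (∈⇒≤namesL o∈os) (ℕP.m≤n⊔m (namesO o') (namesL os))

fresh : ℤ → List Obj → Atom
fresh l os = l , suc (namesL os)

fresh-#P : ∀ l os {X} → pred X ∈ os → fresh l os #P X
fresh-#P l os X∈os f = ℕP.<-irrefl refl (ℕP.≤-trans (free≤namesP f) (∈⇒≤namesL X∈os))

fresh-#S : ∀ l os {x} → set x ∈ os → fresh l os #S x
fresh-#S l os x∈os f = ℕP.<-irrefl refl (ℕP.≤-trans (free≤namesS f) (∈⇒≤namesL x∈os))

fresh-≢ : ∀ l os {c} → atom c ∈ os → fresh l os ≢ c
fresh-≢ l os c∈os refl = ℕP.<-irrefl refl (∈⇒≤namesL c∈os)

pattern 1st = here refl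
pattern 2nd = there 1st
pattern 3rd = there 2nd
pattern 4th = there 3rd
pattern 5th = there 4th
pattern 6th = there 5th
pattern 7th = there 6th

bound-fresh-all : ∀ {a X} → a #P all a X
bound-fresh-all (f-all a≢a _) = a≢a refl

bound-fresh-lam : ∀ {a X} → a #S lam a X
bound-fresh-lam (f-lam a≢a _) = a≢a refl

fresh-all : ∀ {c a X} → c #P X → c #P all a X
fresh-all c#X (f-all _ f) = c#X f

fresh-lam : ∀ {c a X} → c #P X → c #S lam a X
fresh-lam c#X (f-lam _ f) = c#X f

fresh-all-body : ∀ {c a X} → c #P all a X → a ≢ c → c #P X
fresh-all-body c# a≢c f = c# (f-all a≢c f)

lam-fresh⇒all-fresh : ∀ {c a X} → c #S lam a X → c #P all a X
lam-fresh⇒all-fresh c# (f-all a≢c f) = c# (f-lam a≢c f)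

pointwise⇒≈and : ∀ {Xs Ys} → Pointwise _≈P_ Xs Ys → and Xs ≈P and Ys
pointwise⇒≈and ps = ≈-and (forth ps) (back ps)
  where
  forth : ∀ {Xs Ys} → Pointwise _≈P_ Xs Ys → All (λ X → Any (X ≈P_) Ys) Xs
  forth [] = []
  forth (p ∷ ps) = here p ∷ All.map there (forth ps)
  back : ∀ {Xs Ys} → Pointwise _≈P_ Xs Ys → All (λ Y → Any (_≈P Y) Xs) Ys
  back [] = []
  back (p ∷ ps) = here p ∷ All.map there (back ps)

mutual
  ≈P-refl : ∀ X → X ≈P X
  ≈P-refl (and Xs) = pointwise⇒≈and (≈Ps-refl Xs)
  ≈P-refl (neg X) = ≈-neg (≈P-refl X)
  ≈P-refl (all a X) =
    ≈-all a refl refl bound-fresh-all bound-fresh-all (subst (λ T → T ≈P T) (sym (swapP-self a X)) (≈P-refl X))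
  ≈P-refl (mem x a) = ≈-mem (≈S-refl x)

  ≈Ps-refl : ∀ Xs → Pointwise _≈P_ Xs Xs
  ≈Ps-refl [] = []
  ≈Ps-refl (X ∷ Xs) = ≈P-refl X ∷ ≈Ps-refl Xs

  ≈S-refl : ∀ x → x ≈S x
  ≈S-refl (atm a) = ≈-atm
  ≈S-refl (lam a X) =
    ≈-lam a refl refl bound-fresh-lam bound-fresh-lam (subst (λ T → T ≈P T) (sym (swapP-self a X)) (≈P-refl X))

≡⇒≈P : ∀ {X Y} → X ≡ Y → X ≈P Y
≡⇒≈P {X} refl = ≈P-refl X

mutual
  ≈P-sym : ∀ {X Y} → X ≈P Y → Y ≈P X
  ≈P-sym (≈-and forth back) = ≈-and (sym-back back) (sym-forth forth)
  ≈P-sym (≈-neg p) = ≈-neg (≈P-sym p)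
  ≈P-sym (≈-all c la≡lb lc≡la c#X c#Y p) = ≈-all c (sym la≡lb) (trans lc≡la la≡lb) c#Y c#X (≈P-sym p)
  ≈P-sym (≈-mem p) = ≈-mem (≈S-sym p)

  sym-back : ∀ {Xs Ys} → All (λ Y → Any (_≈P Y) Xs) Ys → All (λ Y → Any (Y ≈P_) Xs) Ys
  sym-back [] = []
  sym-back (any ∷ rest) = sym-any-back any ∷ sym-back rest

  sym-any-back : ∀ {Y Xs} → Any (_≈P Y) Xs → Any (Y ≈P_) Xs
  sym-any-back (here p) = here (≈P-sym p)
  sym-any-back (there any) = there (sym-any-back any)

  sym-forth : ∀ {Xs Ys} → All (λ X → Any (X ≈P_) Ys) Xs → All (λ X → Any (_≈P X) Ys) Xs
  sym-forth [] = []
  sym-forth (any ∷ rest) = sym-any-forth any ∷ sym-forth rest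

  sym-any-forth : ∀ {X Ys} → Any (X ≈P_) Ys → Any (_≈P X) Ys
  sym-any-forth (here p) = here (≈P-sym p)
  sym-any-forth (there any) = there (sym-any-forth any)

  ≈S-sym : ∀ {x y} → x ≈S y → y ≈S x
  ≈S-sym ≈-atm = ≈-atm
  ≈S-sym (≈-lam c la≡lb lc≡la c#x c#y p) = ≈-lam c (sym la≡lb) (trans lc≡la la≡lb) c#y c#x (≈P-sym p)

mutual
  ≈P-swap : ∀ {p q} → level p ≡ level q → ∀ {X Y} → X ≈P Y → swapP p q X ≈P swapP p q Y
  ≈P-swap e (≈-and forth back) = ≈-and (swap-forth e forth) (swap-back e back)
  ≈P-swap e (≈-neg r) = ≈-neg (≈P-swap e r)
  ≈P-swap {p} {q} e (≈-all {a} {b} {X} {Y} c la≡lb lc≡la c#X c#Y r) =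
    ≈-all (swapA p q c) (trans (swapA-level a e) (trans la≡lb (sym (swapA-level b e))))
      (trans (swapA-level c e) (trans lc≡la (sym (swapA-level a e))))
      (fresh-swapP p q c#X) (fresh-swapP p q c#Y)
      (subst₂ _≈P_ (swapP-conjugate p q c a X) (swapP-conjugate p q c b Y) (≈P-swap e r))
  ≈P-swap e (≈-mem r) = ≈-mem (≈S-swap e r)

  swap-forth : ∀ {p q} → level p ≡ level q → ∀ {Xs Ys} → All (λ X → Any (X ≈P_) Ys) Xs →
               All (λ X → Any (X ≈P_) (swapPs p q Ys)) (swapPs p q Xs)
  swap-forth e [] = []
  swap-forth e (any ∷ rest) = swap-any-forth e any ∷ swap-forth e rest

  swap-any-forth : ∀ {p q} → level p ≡ level q → ∀ {X Ys} → Any (X ≈P_) Ys →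
                   Any (swapP p q X ≈P_) (swapPs p q Ys)
  swap-any-forth e (here r) = here (≈P-swap e r)
  swap-any-forth e (there any) = there (swap-any-forth e any)

  swap-back : ∀ {p q} → level p ≡ level q → ∀ {Xs Ys} → All (λ Y → Any (_≈P Y) Xs) Ys →
              All (λ Y → Any (_≈P Y) (swapPs p q Xs)) (swapPs p q Ys)
  swap-back e [] = []
  swap-back e (any ∷ rest) = swap-any-back e any ∷ swap-back e rest

  swap-any-back : ∀ {p q} → level p ≡ level q → ∀ {Y Xs} → Any (_≈P Y) Xs →
                  Any (_≈P swapP p q Y) (swapPs p q Xs)
  swap-any-back e (here r) = here (≈P-swap e r)
  swap-any-back e (there any) = there (swap-any-back e any)

  ≈S-swap : ∀ {p q} → level p ≡ level q → ∀ {x y} → x ≈S y → swapS p q x ≈S swapS p q y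
  ≈S-swap e ≈-atm = ≈-atm
  ≈S-swap {p} {q} e (≈-lam {a} {b} {X} {Y} c la≡lb lc≡la c#x c#y r) =
    ≈-lam (swapA p q c) (trans (swapA-level a e) (trans la≡lb (sym (swapA-level b e))))
      (trans (swapA-level c e) (trans lc≡la (sym (swapA-level a e))))
      (fresh-swapS p q c#x) (fresh-swapS p q c#y)
      (subst₂ _≈P_ (swapP-conjugate p q c a X) (swapP-conjugate p q c b Y) (≈P-swap e r))

mutual
  free-≈P : ∀ {e X Y} → X ≈P Y → FreeP e X → FreeP e Y
  free-≈P (≈-and forth _) (f-and any) = f-and (free-forth forth any)
  free-≈P (≈-neg p) (f-neg f) = f-neg (free-≈P p f)
  free-≈P (≈-mem p) (f-mem₁ f) = f-mem₁ (free-≈S p f)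
  free-≈P (≈-mem p) f-mem₂ = f-mem₂
  free-≈P (≈-all c _ _ c#X c#Y p) (f-all a≢e f) =
    let (b≢e , f') = free-body c (λ { refl → c#X (f-all a≢e f) }) c#Y p a≢e f in f-all b≢e f'

  free-forth : ∀ {e Xs Ys} → All (λ X → Any (X ≈P_) Ys) Xs → Any (FreeP e) Xs → Any (FreeP e) Ys
  free-forth (any ∷ _) (here f) = free-any any f
  free-forth (_ ∷ rest) (there f) = free-forth rest f

  free-any : ∀ {e X Ys} → Any (X ≈P_) Ys → FreeP e X → Any (FreeP e) Ys
  free-any (here p) f = here (free-≈P p f)
  free-any (there any) f = there (free-any any f)

  free-≈S : ∀ {e x y} → x ≈S y → FreeS e x → FreeS e y
  free-≈S ≈-atm f = f
  free-≈S (≈-lam c _ _ c#x c#y p) (f-lam a≢e f) =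
    let (b≢e , f') = free-body c (λ { refl → c#x (f-lam a≢e f) }) (lam-fresh⇒all-fresh c#y) p a≢e f
    in f-lam b≢e f'

  free-body : ∀ {e a b X Y} c → e ≢ c → c #P all b Y → swapP c a X ≈P swapP c b Y →
              a ≢ e → FreeP e X → b ≢ e × FreeP e Y
  free-body {e} {a} {b} {X} {Y} c e≢c c#Y p a≢e f = cases (e ≟A b)
    where
    f-swapped : FreeP (swapA c b e) Y
    f-swapped = subst (FreeP (swapA c b e)) (swapP-involutive c b Y)
      (free-swapP c b (free-≈P p (subst (λ t → FreeP t (swapP c a X))
        (swapA-other e≢c (λ e≡a → a≢e (sym e≡a))) (free-swapP c a f))))
    cases : Dec (e ≡ b) → b ≢ e × FreeP e Y
    cases (yes refl) = ⊥-elim (c#Y (f-all e≢c (subst (λ t → FreeP t Y) (swapA-right c e) f-swapped)))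
    cases (no e≢b) = (λ b≡e → e≢b (sym b≡e)) , subst (λ t → FreeP t Y) (swapA-other e≢c e≢b) f-swapped

mutual
  swap-fresh-≈P : ∀ {c d} → level c ≡ level d → ∀ T → c #P T → d #P T → swapP c d T ≈P T
  swap-fresh-≈P l (and Xs) c# d# =
    pointwise⇒≈and (swap-fresh-≈Ps l Xs (λ f → c# (f-and f)) (λ f → d# (f-and f)))
  swap-fresh-≈P l (neg X) c# d# = ≈-neg (swap-fresh-≈P l X (λ f → c# (f-neg f)) (λ f → d# (f-neg f)))
  swap-fresh-≈P {c} {d} l (mem x e) c# d# =
    subst (λ t → mem (swapS c d x) t ≈P mem x e) (sym (swapA-other (λ { refl → c# f-mem₂ }) (λ { refl → d# f-mem₂ })))
      (≈-mem (swap-fresh-≈S l x (λ f → c# (f-mem₁ f)) (λ f → d# (f-mem₁ f))))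
  swap-fresh-≈P {c} {d} l (all e X) c# d# with swapCase c d e
  ... | left refl = subst (λ t → all t (swapP e d X) ≈P all e X) (sym (swapA-left e d))
        (≈-all d (sym l) refl bound-fresh-all d# (≡⇒≈P (trans (swapP-self d _) (swapP-comm e d X))))
  ... | right refl = subst (λ t → all t (swapP c e X) ≈P all e X) (sym (swapA-right c e))
        (≈-all c l refl bound-fresh-all c# (≡⇒≈P (swapP-self c _)))
  ... | other e≢c e≢d = subst (λ t → all t (swapP c d X) ≈P all e X) (sym (swapA-other e≢c e≢d))
        (≈-all e refl refl bound-fresh-all bound-fresh-all
          (subst₂ _≈P_ (sym (swapP-self e _)) (sym (swapP-self e X))
            (swap-fresh-≈P l X (fresh-all-body c# e≢c) (fresh-all-body d# e≢d))))

  swap-fresh-≈Ps : ∀ {c d} → level c ≡ level d → ∀ Xs → ¬ Any (FreeP c) Xs → ¬ Any (FreeP d) Xs →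
                   Pointwise _≈P_ (swapPs c d Xs) Xs
  swap-fresh-≈Ps l [] c# d# = []
  swap-fresh-≈Ps l (X ∷ Xs) c# d# =
    swap-fresh-≈P l X (λ f → c# (here f)) (λ f → d# (here f))
    ∷ swap-fresh-≈Ps l Xs (λ f → c# (there f)) (λ f → d# (there f))

  swap-fresh-≈S : ∀ {c d} → level c ≡ level d → ∀ t → c #S t → d #S t → swapS c d t ≈S t
  swap-fresh-≈S {c} {d} l (atm e) c# d# =
    subst (λ t → atm t ≈S atm e) (sym (swapA-other (λ { refl → c# f-atm }) (λ { refl → d# f-atm }))) ≈-atm
  swap-fresh-≈S {c} {d} l (lam e X) c# d# with swapCase c d e
  ... | left refl = subst (λ t → lam t (swapP e d X) ≈S lam e X) (sym (swapA-left e d))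
        (≈-lam d (sym l) refl bound-fresh-lam d# (≡⇒≈P (trans (swapP-self d _) (swapP-comm e d X))))
  ... | right refl = subst (λ t → lam t (swapP c e X) ≈S lam e X) (sym (swapA-right c e))
        (≈-lam c l refl bound-fresh-lam c# (≡⇒≈P (swapP-self c _)))
  ... | other e≢c e≢d = subst (λ t → lam t (swapP c d X) ≈S lam e X) (sym (swapA-other e≢c e≢d))
        (≈-lam e refl refl bound-fresh-lam bound-fresh-lam
          (subst₂ _≈P_ (sym (swapP-self e _)) (sym (swapP-self e X))
            (swap-fresh-≈P l X (fresh-all-body (lam-fresh⇒all-fresh c#) e≢c)
                               (fresh-all-body (lam-fresh⇒all-fresh d#) e≢d))))

rename-via : ∀ {a c d} X → c #P all a X → d #P all a X → level c ≡ level a → level d ≡ level a →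
             swapP d a X ≈P swapP c d (swapP c a X)
rename-via {a} {c} {d} X c# d# lc ld with a ≟A c | a ≟A d
... | yes refl | _ = ≡⇒≈P (trans (swapP-comm d a X) (cong (swapP a d) (sym (swapP-self a X))))
... | no _ | yes refl = ≡⇒≈P (trans (swapP-self a X) (sym (swapP-involutive c a X)))
... | no a≢c | no a≢d = subst (swapP d a X ≈P_) (sym conj)
        (≈P-sym (≈P-swap ld (swap-fresh-≈P (trans lc (sym ld)) X (fresh-all-body c# a≢c) (fresh-all-body d# a≢d))))
  where
  conj : swapP c d (swapP c a X) ≡ swapP d a (swapP c d X)
  conj = trans (swapP-conjugate c d c a X)
               (cong₂ (λ u v → swapP u v (swapP c d X)) (swapA-left c d) (swapA-other a≢c a≢d))

record BinderEquiv (a : Atom) (X : Pred) (b : Atom) (Y : Pred) : Set where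
  constructor binder
  field
    witness : Atom
    same-level : level a ≡ level b
    witness-level : level witness ≡ level a
    fresh-left : witness #P all a X
    fresh-right : witness #P all b Y
    bodies : swapP witness a X ≈P swapP witness b Y

all≈⇒binder : ∀ {a b X Y} → all a X ≈P all b Y → BinderEquiv a X b Y
all≈⇒binder (≈-all c la≡lb lc≡la c#X c#Y p) = binder c la≡lb lc≡la c#X c#Y p

lam≈⇒binder : ∀ {a b X Y} → lam a X ≈S lam b Y → BinderEquiv a X b Y
lam≈⇒binder (≈-lam c la≡lb lc≡la c#X c#Y p) =
  binder c la≡lb lc≡la (lam-fresh⇒all-fresh c#X) (lam-fresh⇒all-fresh c#Y) p

binder⇒all≈ : ∀ {a b X Y} → BinderEquiv a X b Y → all a X ≈P all b Y
binder⇒all≈ (binder c la≡lb lc≡la c#X c#Y p) = ≈-all c la≡lb lc≡la c#X c#Y p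

binder⇒lam≈ : ∀ {a b X Y} → BinderEquiv a X b Y → lam a X ≈S lam b Y
binder⇒lam≈ (binder c la≡lb lc≡la c#X c#Y p) =
  ≈-lam c la≡lb lc≡la (λ { (f-lam a≢c f) → c#X (f-all a≢c f) }) (λ { (f-lam b≢c f) → c#Y (f-all b≢c f) }) p

-- In the binder case a new atom d fresh for all three bodies is chosen, and
-- both equivalences are transported to d ("some fresh witness ⇒ any").

mutual
  ≈P-trans≤ : ∀ n {X Y W} → sizeP X ℕ.≤ n → X ≈P Y → Y ≈P W → X ≈P W
  ≈P-trans≤ (suc n) (s≤s sz) (≈-and forth₁ back₁) (≈-and forth₂ back₂) =
    ≈-and (trans-forth n sz forth₁ forth₂) (trans-back n sz back₂ back₁)
  ≈P-trans≤ (suc n) (s≤s sz) (≈-neg p) (≈-neg q) = ≈-neg (≈P-trans≤ n sz p q)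
  ≈P-trans≤ (suc n) (s≤s sz) (≈-mem p) (≈-mem q) = ≈-mem (≈S-trans≤ n sz p q)
  ≈P-trans≤ (suc n) (s≤s sz) p@(≈-all _ _ _ _ _ _) q@(≈-all _ _ _ _ _ _) =
    binder⇒all≈ (trans-binders n sz (all≈⇒binder p) (all≈⇒binder q))

  ≈S-trans≤ : ∀ n {x y w} → sizeS x ℕ.≤ n → x ≈S y → y ≈S w → x ≈S w
  ≈S-trans≤ n sz ≈-atm q = q
  ≈S-trans≤ (suc n) (s≤s sz) p@(≈-lam _ _ _ _ _ _) q@(≈-lam _ _ _ _ _ _) =
    binder⇒lam≈ (trans-binders n sz (lam≈⇒binder p) (lam≈⇒binder q))

  trans-binders : ∀ n {a b e X Y W} → sizeP X ℕ.≤ n → BinderEquiv a X b Y → BinderEquiv b Y e W →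
                  BinderEquiv a X e W
  trans-binders n {a} {b} {e} {X} {Y} {W} sz XY YW =
    binder d (trans la≡lb lb≡le) refl (fresh-all (fresh-#P _ os 1st)) (fresh-all (fresh-#P _ os 3rd))
      (rebind n sz' (rebind n sz' (≈P-refl (swapP d a X)) XY
                       (fresh-all (fresh-#P _ os 1st)) (fresh-all (fresh-#P _ os 2nd)) refl)
        YW (fresh-all (fresh-#P _ os 2nd)) (fresh-all (fresh-#P _ os 3rd)) la≡lb)
    where
    os : List Obj
    os = pred X ∷ pred Y ∷ pred W ∷ []
    d : Atom
    d = fresh (level a) os
    la≡lb : level a ≡ level b
    la≡lb = BinderEquiv.same-level XY
    lb≡le : level b ≡ level e
    lb≡le = BinderEquiv.same-level YW
    sz' : sizeP (swapP d a X) ℕ.≤ n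
    sz' = subst (ℕ._≤ n) (sym (size-swapP d a X)) sz

  rebind : ∀ n {T a b d X Y} → sizeP T ℕ.≤ n → T ≈P swapP d a X → BinderEquiv a X b Y →
           d #P all a X → d #P all b Y → level d ≡ level a → T ≈P swapP d b Y
  rebind n {X = X} {Y} sz T≈ (binder c la≡lb lc≡la c#X c#Y p) d#X d#Y ld≡la =
    ≈P-trans≤ n sz (≈P-trans≤ n sz (≈P-trans≤ n sz T≈ (rename-via X c#X d#X lc≡la ld≡la))
                                     (≈P-swap (trans lc≡la (sym ld≡la)) p))
                   (≈P-sym (rename-via Y c#Y d#Y (trans lc≡la la≡lb) (trans ld≡la la≡lb)))

  trans-forth : ∀ n {Xs Ys Ws} → sizePs Xs ℕ.≤ n → All (λ X → Any (X ≈P_) Ys) Xs →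
                All (λ Y → Any (Y ≈P_) Ws) Ys → All (λ X → Any (X ≈P_) Ws) Xs
  trans-forth n sz [] _ = []
  trans-forth n {X ∷ _} sz (any ∷ rest) forth =
    trans-any-forth n (ℕP.m+n≤o⇒m≤o (sizeP X) sz) any forth ∷ trans-forth n (ℕP.m+n≤o⇒n≤o (sizeP X) sz) rest forth

  trans-any-forth : ∀ n {X Ys Ws} → sizeP X ℕ.≤ n → Any (X ≈P_) Ys →
                    All (λ Y → Any (Y ≈P_) Ws) Ys → Any (X ≈P_) Ws
  trans-any-forth n sz (here p) (any ∷ _) = Any.map (≈P-trans≤ n sz p) any
  trans-any-forth n sz (there any) (_ ∷ rest) = trans-any-forth n sz any rest

  trans-back : ∀ n {Xs Ys Ws} → sizePs Xs ℕ.≤ n → All (λ W → Any (_≈P W) Ys) Ws →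
               All (λ Y → Any (_≈P Y) Xs) Ys → All (λ W → Any (_≈P W) Xs) Ws
  trans-back n sz [] _ = []
  trans-back n sz (any ∷ rest) back = trans-any-back n sz any back ∷ trans-back n sz rest back

  trans-any-back : ∀ n {Xs Ys W} → sizePs Xs ℕ.≤ n → Any (_≈P W) Ys →
                   All (λ Y → Any (_≈P Y) Xs) Ys → Any (_≈P W) Xs
  trans-any-back n sz (here q) (any ∷ _) = trans-any-before n sz q any
  trans-any-back n sz (there any) (_ ∷ rest) = trans-any-back n sz any rest

  trans-any-before : ∀ n {Xs Y W} → sizePs Xs ℕ.≤ n → Y ≈P W → Any (_≈P Y) Xs → Any (_≈P W) Xs
  trans-any-before n {X ∷ _} sz q (here p) = here (≈P-trans≤ n (ℕP.m+n≤o⇒m≤o (sizeP X) sz) p q)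
  trans-any-before n {X ∷ _} sz q (there any) = there (trans-any-before n (ℕP.m+n≤o⇒n≤o (sizeP X) sz) q any)

≈P-trans : ∀ {X Y W} → X ≈P Y → Y ≈P W → X ≈P W
≈P-trans {X} = ≈P-trans≤ (sizeP X) ℕP.≤-refl

≈S-trans : ∀ {x y w} → x ≈S y → y ≈S w → x ≈S w
≈S-trans {x} = ≈S-trans≤ (sizeS x) ℕP.≤-refl

binder-bodies : ∀ {a b d X Y} → BinderEquiv a X b Y → d #P X → d #P Y → level d ≡ level a →
                swapP d a X ≈P swapP d b Y
binder-bodies {a} {d = d} {X} XY d#X d#Y ld≡la =
  rebind _ ℕP.≤-refl (≈P-refl (swapP d a X)) XY (fresh-all d#X) (fresh-all d#Y) ld≡la

-- Derivations of the σ-action.  Uniqueness is proved by recursion on their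
-- depth, since renamed derivations are not subterms of the original ones.

mutual
  depthP : ∀ {a x Z R} → SubP a x Z R → ℕ
  depthP (s-α _ _ d _) = suc (depthP d)
  depthP (s-and ds) = suc (depthPs ds)
  depthP (s-neg d) = suc (depthP d)
  depthP (s-all _ _ d) = suc (depthP d)
  depthP (s-mem-atm _ d) = suc (depthS d)
  depthP (s-mem-lam _ _ _ _ dy dX) = suc (depthS dy ℕ.+ depthP dX)
  depthP (s-mem _ d) = suc (depthS d)

  depthPs : ∀ {a x Xs Rs} → Pointwise (SubP a x) Xs Rs → ℕ
  depthPs [] = 0
  depthPs (d ∷ ds) = depthP d ℕ.+ depthPs ds

  depthS : ∀ {a x z r} → SubS a x z r → ℕ
  depthS (s-α _ _ d _) = suc (depthS d)
  depthS s-atm-a = 1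
  depthS (s-atm-b _) = 1
  depthS (s-lam _ _ d) = suc (depthP d)

mutual
  swapSubP : ∀ p q → level p ≡ level q → ∀ {a x Z R} → SubP a x Z R →
             SubP (swapA p q a) (swapS p q x) (swapP p q Z) (swapP p q R)
  swapSubP p q e (s-α xx ZZ d RR) = s-α (≈S-swap e xx) (≈P-swap e ZZ) (swapSubP p q e d) (≈P-swap e RR)
  swapSubP p q e (s-and ds) = s-and (swapSubPs p q e ds)
  swapSubP p q e (s-neg d) = s-neg (swapSubP p q e d)
  swapSubP p q e (s-all b≢a b#x d) = s-all (swap-≢ p q b≢a) (fresh-swapS p q b#x) (swapSubP p q e d)
  swapSubP p q e (s-mem-atm x≡n d) = s-mem-atm (cong (swapS p q) x≡n) (swapSubS p q e d)
  swapSubP p q e (s-mem-lam x≡ a'≢a a'#y a'#y' dy dX) =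
    s-mem-lam (cong (swapS p q) x≡) (swap-≢ p q a'≢a) (fresh-swapS p q a'#y) (fresh-swapS p q a'#y')
      (swapSubS p q e dy) (swapSubP p q e dX)
  swapSubP p q e (s-mem b≢a d) = s-mem (swap-≢ p q b≢a) (swapSubS p q e d)

  swapSubPs : ∀ p q → level p ≡ level q → ∀ {a x Xs Rs} → Pointwise (SubP a x) Xs Rs →
              Pointwise (SubP (swapA p q a) (swapS p q x)) (swapPs p q Xs) (swapPs p q Rs)
  swapSubPs p q e [] = []
  swapSubPs p q e (d ∷ ds) = swapSubP p q e d ∷ swapSubPs p q e ds

  swapSubS : ∀ p q → level p ≡ level q → ∀ {a x z r} → SubS a x z r →
             SubS (swapA p q a) (swapS p q x) (swapS p q z) (swapS p q r)
  swapSubS p q e (s-α xx zz d rr) = s-α (≈S-swap e xx) (≈S-swap e zz) (swapSubS p q e d) (≈S-swap e rr)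
  swapSubS p q e s-atm-a = s-atm-a
  swapSubS p q e (s-atm-b b≢a) = s-atm-b (swap-≢ p q b≢a)
  swapSubS p q e (s-lam c≢a c#x d) = s-lam (swap-≢ p q c≢a) (fresh-swapS p q c#x) (swapSubP p q e d)

mutual
  depth-swapSubP : ∀ p q (e : level p ≡ level q) {a x Z R} (d : SubP a x Z R) →
                   depthP (swapSubP p q e d) ≡ depthP d
  depth-swapSubP p q e (s-α _ _ d _) = cong suc (depth-swapSubP p q e d)
  depth-swapSubP p q e (s-and ds) = cong suc (depth-swapSubPs p q e ds)
  depth-swapSubP p q e (s-neg d) = cong suc (depth-swapSubP p q e d)
  depth-swapSubP p q e (s-all _ _ d) = cong suc (depth-swapSubP p q e d)
  depth-swapSubP p q e (s-mem-atm _ d) = cong suc (depth-swapSubS p q e d)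
  depth-swapSubP p q e (s-mem-lam _ _ _ _ dy dX) = cong suc (cong₂ ℕ._+_ (depth-swapSubS p q e dy) (depth-swapSubP p q e dX))
  depth-swapSubP p q e (s-mem _ d) = cong suc (depth-swapSubS p q e d)

  depth-swapSubPs : ∀ p q (e : level p ≡ level q) {a x Xs Rs} (ds : Pointwise (SubP a x) Xs Rs) →
                    depthPs (swapSubPs p q e ds) ≡ depthPs ds
  depth-swapSubPs p q e [] = refl
  depth-swapSubPs p q e (d ∷ ds) = cong₂ ℕ._+_ (depth-swapSubP p q e d) (depth-swapSubPs p q e ds)

  depth-swapSubS : ∀ p q (e : level p ≡ level q) {a x z r} (d : SubS a x z r) →
                   depthS (swapSubS p q e d) ≡ depthS d
  depth-swapSubS p q e (s-α _ _ d _) = cong suc (depth-swapSubS p q e d)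
  depth-swapSubS p q e s-atm-a = refl
  depth-swapSubS p q e (s-atm-b _) = refl
  depth-swapSubS p q e (s-lam _ _ d) = cong suc (depth-swapSubP p q e d)

renameSubP : ∀ p q {a a' x Z R} → level p ≡ level q → swapA p q a ≡ a' → SubP a x Z R →
             SubP a' (swapS p q x) (swapP p q Z) (swapP p q R)
renameSubP p q e refl d = swapSubP p q e d

depth-renameSubP : ∀ p q {a a' x Z R} (e : level p ≡ level q) (a↦a' : swapA p q a ≡ a') (d : SubP a x Z R) →
                   depthP (renameSubP p q e a↦a' d) ≡ depthP d
depth-renameSubP p q e refl d = depth-swapSubP p q e d

mutual
  free-resultP : ∀ {a x Z R c} → SubP a x Z R → FreeP c R → (FreeP c Z × c ≢ a) ⊎ FreeS c x
  free-resultP (s-α xx ZZ d RR) f with free-resultP d (free-≈P (≈P-sym RR) f)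
  ... | inj₁ (g , c≢a) = inj₁ (free-≈P (≈P-sym ZZ) g , c≢a)
  ... | inj₂ g = inj₂ (free-≈S (≈S-sym xx) g)
  free-resultP (s-and ds) (f-and any) = Sum.map₁ (Product.map₁ f-and) (free-resultPs ds any)
  free-resultP (s-neg d) (f-neg f) = Sum.map₁ (Product.map₁ f-neg) (free-resultP d f)
  free-resultP (s-all _ _ d) (f-all b≢c f) = Sum.map₁ (Product.map₁ (f-all b≢c)) (free-resultP d f)
  free-resultP (s-mem-atm _ d) (f-mem₁ f) = Sum.map₁ (Product.map₁ f-mem₁) (free-resultS d f)
  free-resultP (s-mem-atm x≡n _) f-mem₂ = inj₂ (subst (FreeS _) (sym x≡n) f-atm)
  free-resultP (s-mem-lam x≡ _ _ _ dy dX) f with free-resultP dX f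
  ... | inj₁ (g , c≢a') = inj₂ (subst (FreeS _) (sym x≡) (f-lam (λ a'≡c → c≢a' (sym a'≡c)) g))
  ... | inj₂ g = Sum.map₁ (Product.map₁ f-mem₁) (free-resultS dy g)
  free-resultP (s-mem _ d) (f-mem₁ f) = Sum.map₁ (Product.map₁ f-mem₁) (free-resultS d f)
  free-resultP (s-mem b≢a _) f-mem₂ = inj₁ (f-mem₂ , b≢a)

  free-resultPs : ∀ {a x Xs Rs c} → Pointwise (SubP a x) Xs Rs → Any (FreeP c) Rs →
                  (Any (FreeP c) Xs × c ≢ a) ⊎ FreeS c x
  free-resultPs (d ∷ _) (here f) = Sum.map₁ (Product.map₁ here) (free-resultP d f)
  free-resultPs (_ ∷ ds) (there any) = Sum.map₁ (Product.map₁ there) (free-resultPs ds any)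

  free-resultS : ∀ {a x z r c} → SubS a x z r → FreeS c r → (FreeS c z × c ≢ a) ⊎ FreeS c x
  free-resultS (s-α xx zz d rr) f with free-resultS d (free-≈S (≈S-sym rr) f)
  ... | inj₁ (g , c≢a) = inj₁ (free-≈S (≈S-sym zz) g , c≢a)
  ... | inj₂ g = inj₂ (free-≈S (≈S-sym xx) g)
  free-resultS s-atm-a f = inj₂ f
  free-resultS (s-atm-b b≢a) f-atm = inj₁ (f-atm , b≢a)
  free-resultS (s-lam _ _ d) (f-lam c≢e f) = Sum.map₁ (Product.map₁ (f-lam c≢e)) (free-resultP d f)

fresh-result : ∀ {a x Z R} → a #S x → SubP a x Z R → a #P R
fresh-result a#x d f with free-resultP d f
... | inj₁ (_ , a≢a) = a≢a refl
... | inj₂ g = a#x g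

≈S-rename-fresh : ∀ {e b b' x x'} → level e ≡ level b → level e ≡ level b' →
                  e #S x → b #S x → e #S x' → b' #S x' → x ≈S x' → swapS e b x ≈S swapS e b' x'
≈S-rename-fresh {x = x} {x'} le≡lb le≡lb' e#x b#x e#x' b'#x' xx =
  ≈S-trans (swap-fresh-≈S le≡lb x e#x b#x) (≈S-trans xx (≈S-sym (swap-fresh-≈S le≡lb' x' e#x' b'#x')))

atm≈atm : ∀ {n m} → atm n ≈S atm m → n ≡ m
atm≈atm ≈-atm = refl

atm≉lam : ∀ {n b X} → ¬ (atm n ≈S lam b X)
atm≉lam ()

-- The
-- bounds n₁, n₂ on the depths decrease lexicographically; in the binder and
-- ∈(y,a)[a ↦ [a']X] cases both derivations are renamed to a common fresh atom.

mutual
  uniqueP : ∀ {a x x' Z Z' R R'} (d₁ : SubP a x Z R) (d₂ : SubP a x' Z' R') n₁ n₂ →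
            depthP d₁ ℕ.≤ n₁ → depthP d₂ ℕ.≤ n₂ → x ≈S x' → Z ≈P Z' → R ≈P R'
  uniqueP (s-α xx₁ ZZ₁ d₁ RR₁) d₂ (suc n₁) n₂ (s≤s s₁) s₂ xx ZZ =
    ≈P-trans (≈P-sym RR₁)
      (uniqueP d₁ d₂ n₁ n₂ s₁ s₂ (≈S-trans (≈S-sym xx₁) xx) (≈P-trans (≈P-sym ZZ₁) ZZ))
  uniqueP d₁ (s-α xx₂ ZZ₂ d₂ RR₂) n₁ (suc n₂) s₁ (s≤s s₂) xx ZZ =
    ≈P-trans (uniqueP d₁ d₂ n₁ n₂ s₁ s₂ (≈S-trans xx xx₂) (≈P-trans ZZ ZZ₂)) RR₂
  uniqueP (s-and ds₁) (s-and ds₂) (suc n₁) (suc n₂) (s≤s s₁) (s≤s s₂) xx (≈-and forth back) =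
    ≈-and (unique-forth ds₁ ds₂ n₁ n₂ s₁ s₂ xx forth) (unique-back ds₁ ds₂ n₁ n₂ s₁ s₂ xx back)
  uniqueP (s-neg d₁) (s-neg d₂) (suc n₁) (suc n₂) (s≤s s₁) (s≤s s₂) xx (≈-neg ZZ) =
    ≈-neg (uniqueP d₁ d₂ n₁ n₂ s₁ s₂ xx ZZ)
  uniqueP (s-all b≢a b#x d₁) (s-all b'≢a b'#x' d₂) (suc n₁) (suc n₂) (s≤s s₁) (s≤s s₂) xx ZZ =
    binder⇒all≈ (unique-body d₁ d₂ n₁ n₂ s₁ s₂ b≢a b'≢a b#x b'#x' xx (all≈⇒binder ZZ))
  uniqueP (s-mem-atm x≡n₁ dy₁) (s-mem-atm x≡n₂ dy₂) (suc n₁) (suc n₂) (s≤s s₁) (s≤s s₂) xx (≈-mem yy)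
    with atm≈atm (subst₂ _≈S_ x≡n₁ x≡n₂ xx)
  ... | refl = ≈-mem (uniqueS dy₁ dy₂ n₁ n₂ s₁ s₂ xx yy)
  uniqueP (s-mem-lam x≡₁ _ _ a₁#y₁' dy₁ dX₁) (s-mem-lam x≡₂ _ _ a₂#y₂' dy₂ dX₂)
          (suc n₁) (suc n₂) (s≤s s₁) (s≤s s₂) xx (≈-mem yy) =
    unique-instantiate dX₁ dX₂ n₁ n₂ (ℕP.m+n≤o⇒n≤o (depthS dy₁) s₁) (ℕP.m+n≤o⇒n≤o (depthS dy₂) s₂)
      a₁#y₁' a₂#y₂'
      (uniqueS dy₁ dy₂ n₁ n₂ (ℕP.m+n≤o⇒m≤o (depthS dy₁) s₁) (ℕP.m+n≤o⇒m≤o (depthS dy₂) s₂) xx yy)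
      (subst₂ _≈S_ x≡₁ x≡₂ xx)
  uniqueP (s-mem _ dy₁) (s-mem _ dy₂) (suc n₁) (suc n₂) (s≤s s₁) (s≤s s₂) xx (≈-mem yy) =
    ≈-mem (uniqueS dy₁ dy₂ n₁ n₂ s₁ s₂ xx yy)
  -- The remaining combinations contradict x ≈ x' or the choice of equation for ∈(y,b).
  uniqueP (s-mem-atm x≡n _) (s-mem-lam x≡ _ _ _ _ _) _ _ _ _ xx (≈-mem _) = ⊥-elim (atm≉lam (subst₂ _≈S_ x≡n x≡ xx))
  uniqueP (s-mem-lam x≡ _ _ _ _ _) (s-mem-atm x≡n _) _ _ _ _ xx (≈-mem _) =
    ⊥-elim (atm≉lam (subst₂ _≈S_ x≡n x≡ (≈S-sym xx)))
  uniqueP (s-mem a≢a _) (s-mem-atm _ _) _ _ _ _ _ (≈-mem _) = ⊥-elim (a≢a refl)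
  uniqueP (s-mem a≢a _) (s-mem-lam _ _ _ _ _ _) _ _ _ _ _ (≈-mem _) = ⊥-elim (a≢a refl)
  uniqueP (s-mem-atm _ _) (s-mem a≢a _) _ _ _ _ _ (≈-mem _) = ⊥-elim (a≢a refl)
  uniqueP (s-mem-lam _ _ _ _ _ _) (s-mem a≢a _) _ _ _ _ _ (≈-mem _) = ⊥-elim (a≢a refl)

  uniqueS : ∀ {a x x' z z' r r'} (d₁ : SubS a x z r) (d₂ : SubS a x' z' r') n₁ n₂ →
            depthS d₁ ℕ.≤ n₁ → depthS d₂ ℕ.≤ n₂ → x ≈S x' → z ≈S z' → r ≈S r'
  uniqueS (s-α xx₁ zz₁ d₁ rr₁) d₂ (suc n₁) n₂ (s≤s s₁) s₂ xx zz =
    ≈S-trans (≈S-sym rr₁)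
      (uniqueS d₁ d₂ n₁ n₂ s₁ s₂ (≈S-trans (≈S-sym xx₁) xx) (≈S-trans (≈S-sym zz₁) zz))
  uniqueS d₁ (s-α xx₂ zz₂ d₂ rr₂) n₁ (suc n₂) s₁ (s≤s s₂) xx zz =
    ≈S-trans (uniqueS d₁ d₂ n₁ n₂ s₁ s₂ (≈S-trans xx xx₂) (≈S-trans zz zz₂)) rr₂
  uniqueS s-atm-a s-atm-a _ _ _ _ xx _ = xx
  uniqueS (s-atm-b _) (s-atm-b _) _ _ _ _ _ ≈-atm = ≈-atm
  uniqueS s-atm-a (s-atm-b a≢a) _ _ _ _ _ ≈-atm = ⊥-elim (a≢a refl)
  uniqueS (s-atm-b a≢a) s-atm-a _ _ _ _ _ ≈-atm = ⊥-elim (a≢a refl)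
  uniqueS (s-lam b≢a b#x d₁) (s-lam b'≢a b'#x' d₂) (suc n₁) (suc n₂) (s≤s s₁) (s≤s s₂) xx zz =
    binder⇒lam≈ (unique-body d₁ d₂ n₁ n₂ s₁ s₂ b≢a b'≢a b#x b'#x' xx (lam≈⇒binder zz))

  -- The body of an abstraction over b ≢ a: rename both derivations to a fresh e.
  unique-body : ∀ {a b b' x x' X X' R R'} (d₁ : SubP a x X R) (d₂ : SubP a x' X' R') n₁ n₂ →
                depthP d₁ ℕ.≤ n₁ → depthP d₂ ℕ.≤ n₂ → b ≢ a → b' ≢ a → b #S x → b' #S x' →
                x ≈S x' → BinderEquiv b X b' X' → BinderEquiv b R b' R'
  unique-body {a} {b} {b'} {x} {x'} {X} {X'} {R} {R'} d₁ d₂ n₁ n₂ s₁ s₂ b≢a b'≢a b#x b'#x' xx XX =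
    binder e lb≡lb' refl (fresh-all (fresh-#P _ os 3rd)) (fresh-all (fresh-#P _ os 4th))
      (unique-renamed d₁ d₂ n₁ n₂ s₁ s₂ refl lb≡lb' (swapA-other a≢e (λ a≡b → b≢a (sym a≡b)))
        (swapA-other a≢e (λ a≡b' → b'≢a (sym a≡b')))
        (≈S-rename-fresh refl lb≡lb' (fresh-#S _ os 5th) b#x (fresh-#S _ os 6th) b'#x' xx)
        (binder-bodies XX (fresh-#P _ os 1st) (fresh-#P _ os 2nd) refl))
    where
    os : List Obj
    os = pred X ∷ pred X' ∷ pred R ∷ pred R' ∷ set x ∷ set x' ∷ atom a ∷ []
    e : Atom
    e = fresh (level b) os
    a≢e : a ≢ e
    a≢e a≡e = fresh-≢ _ os 7th (sym a≡e)
    lb≡lb' : level b ≡ level b'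
    lb≡lb' = BinderEquiv.same-level XX

  unique-instantiate : ∀ {a₁ a₂ y₁ y₂ X₁ X₂ R₁ R₂}
                       (d₁ : SubP a₁ y₁ X₁ R₁) (d₂ : SubP a₂ y₂ X₂ R₂) n₁ n₂ →
                       depthP d₁ ℕ.≤ n₁ → depthP d₂ ℕ.≤ n₂ → a₁ #S y₁ → a₂ #S y₂ → y₁ ≈S y₂ →
                       lam a₁ X₁ ≈S lam a₂ X₂ → R₁ ≈P R₂
  unique-instantiate {a₁} {a₂} {y₁} {y₂} {X₁} {X₂} {R₁} {R₂} d₁ d₂ n₁ n₂ s₁ s₂ a₁#y₁ a₂#y₂ yy XX =
    ≈P-trans (≈P-sym (swap-fresh-≈P refl R₁ (fresh-#P _ os 3rd) (fresh-result a₁#y₁ d₁)))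
      (≈P-trans renamed (swap-fresh-≈P la₁≡la₂ R₂ (fresh-#P _ os 4th) (fresh-result a₂#y₂ d₂)))
    where
    os : List Obj
    os = pred X₁ ∷ pred X₂ ∷ pred R₁ ∷ pred R₂ ∷ set y₁ ∷ set y₂ ∷ []
    e : Atom
    e = fresh (level a₁) os
    bodies : BinderEquiv a₁ X₁ a₂ X₂
    bodies = lam≈⇒binder XX
    la₁≡la₂ : level a₁ ≡ level a₂
    la₁≡la₂ = BinderEquiv.same-level bodies
    renamed : swapP e a₁ R₁ ≈P swapP e a₂ R₂
    renamed = unique-renamed d₁ d₂ n₁ n₂ s₁ s₂ refl la₁≡la₂ (swapA-right e a₁) (swapA-right e a₂)
                (≈S-rename-fresh refl la₁≡la₂ (fresh-#S _ os 5th) a₁#y₁ (fresh-#S _ os 6th) a₂#y₂ yy)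
                (binder-bodies bodies (fresh-#P _ os 1st) (fresh-#P _ os 2nd) refl)

  unique-renamed : ∀ {e b₁ b₂ a₁ a₂ a x₁ x₂ X₁ X₂ R₁ R₂}
                   (d₁ : SubP a₁ x₁ X₁ R₁) (d₂ : SubP a₂ x₂ X₂ R₂) n₁ n₂ →
                   depthP d₁ ℕ.≤ n₁ → depthP d₂ ℕ.≤ n₂ → level e ≡ level b₁ → level e ≡ level b₂ →
                   swapA e b₁ a₁ ≡ a → swapA e b₂ a₂ ≡ a → swapS e b₁ x₁ ≈S swapS e b₂ x₂ →
                   swapP e b₁ X₁ ≈P swapP e b₂ X₂ → swapP e b₁ R₁ ≈P swapP e b₂ R₂
  unique-renamed {e} {b₁} {b₂} d₁ d₂ n₁ n₂ s₁ s₂ l₁ l₂ a₁↦a a₂↦a =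
    uniqueP (renameSubP e b₁ l₁ a₁↦a d₁) (renameSubP e b₂ l₂ a₂↦a d₂) n₁ n₂
      (subst (ℕ._≤ n₁) (sym (depth-renameSubP e b₁ l₁ a₁↦a d₁)) s₁)
      (subst (ℕ._≤ n₂) (sym (depth-renameSubP e b₂ l₂ a₂↦a d₂)) s₂)

  unique-forth : ∀ {a x x' Xs Ys Rs Rs'} (ds₁ : Pointwise (SubP a x) Xs Rs) (ds₂ : Pointwise (SubP a x') Ys Rs') n₁ n₂ →
                 depthPs ds₁ ℕ.≤ n₁ → depthPs ds₂ ℕ.≤ n₂ → x ≈S x' →
                 All (λ X → Any (X ≈P_) Ys) Xs → All (λ R → Any (R ≈P_) Rs') Rs
  unique-forth [] _ n₁ n₂ _ _ _ [] = []
  unique-forth (d ∷ ds₁) ds₂ n₁ n₂ s₁ s₂ xx (any ∷ rest) =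
    unique-any-forth d ds₂ n₁ n₂ (ℕP.m+n≤o⇒m≤o (depthP d) s₁) s₂ xx any
    ∷ unique-forth ds₁ ds₂ n₁ n₂ (ℕP.m+n≤o⇒n≤o (depthP d) s₁) s₂ xx rest

  unique-any-forth : ∀ {a x x' X R Ys Rs'} (d : SubP a x X R) (ds₂ : Pointwise (SubP a x') Ys Rs') n₁ n₂ →
                     depthP d ℕ.≤ n₁ → depthPs ds₂ ℕ.≤ n₂ → x ≈S x' → Any (X ≈P_) Ys → Any (R ≈P_) Rs'
  unique-any-forth d (d₂ ∷ _) n₁ n₂ s₁ s₂ xx (here XY) =
    here (uniqueP d d₂ n₁ n₂ s₁ (ℕP.m+n≤o⇒m≤o (depthP d₂) s₂) xx XY)
  unique-any-forth d (d₂ ∷ ds₂) n₁ n₂ s₁ s₂ xx (there any) =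
    there (unique-any-forth d ds₂ n₁ n₂ s₁ (ℕP.m+n≤o⇒n≤o (depthP d₂) s₂) xx any)

  unique-back : ∀ {a x x' Xs Ys Rs Rs'} (ds₁ : Pointwise (SubP a x) Xs Rs) (ds₂ : Pointwise (SubP a x') Ys Rs') n₁ n₂ →
                depthPs ds₁ ℕ.≤ n₁ → depthPs ds₂ ℕ.≤ n₂ → x ≈S x' →
                All (λ Y → Any (_≈P Y) Xs) Ys → All (λ R' → Any (_≈P R') Rs) Rs'
  unique-back _ [] n₁ n₂ _ _ _ [] = []
  unique-back ds₁ (d ∷ ds₂) n₁ n₂ s₁ s₂ xx (any ∷ rest) =
    unique-any-back ds₁ d n₁ n₂ s₁ (ℕP.m+n≤o⇒m≤o (depthP d) s₂) xx any
    ∷ unique-back ds₁ ds₂ n₁ n₂ s₁ (ℕP.m+n≤o⇒n≤o (depthP d) s₂) xx rest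

  unique-any-back : ∀ {a x x' Y R' Xs Rs} (ds₁ : Pointwise (SubP a x) Xs Rs) (d : SubP a x' Y R') n₁ n₂ →
                    depthPs ds₁ ℕ.≤ n₁ → depthP d ℕ.≤ n₂ → x ≈S x' → Any (_≈P Y) Xs → Any (_≈P R') Rs
  unique-any-back (d₁ ∷ _) d n₁ n₂ s₁ s₂ xx (here XY) =
    here (uniqueP d₁ d n₁ n₂ (ℕP.m+n≤o⇒m≤o (depthP d₁) s₁) s₂ xx XY)
  unique-any-back (d₁ ∷ ds₁) d n₁ n₂ s₁ s₂ xx (there any) =
    there (unique-any-back ds₁ d n₁ n₂ (ℕP.m+n≤o⇒n≤o (depthP d₁) s₁) s₂ xx any)

-- Conditions under which Z[a ↦ x] is computed with every level staying ≥ m: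
-- x ∈ 𝓛_ℓ for ℓ = level a, m ≤ ℓ, m ≤ minlev x, and a budget k with ℓ ≤ m + k.
-- Unfolding ∈(y,a)[a ↦ [a']X] substitutes for a' of level ℓ - 1, spending
-- one unit of budget; with budget 0 it cannot occur, as m ≤ ℓ - 1 < ℓ ≤ m.
record Admissible (k : ℕ) (m ℓ : ℤ) (x : St) : Set where
  field
    wf : IsSet ℓ x
    budget : ℓ ≤ m + + k
    m≤ℓ : m ≤ ℓ
    m≤x : m ≤ minlevS x

budget-step : ∀ {ℓ m} k → ℓ ≤ m + + suc k → ℓ - 1ℤ ≤ m + + k
budget-step {ℓ} {m} k ℓ≤ = subst (ℓ - 1ℤ ≤_) (drop-one m (+ k)) (ℤP.+-monoˡ-≤ (- 1ℤ) ℓ≤)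
  where
  drop-one : ∀ m k → (m + (1ℤ + k)) - 1ℤ ≡ m + k
  drop-one = solve-∀

budget-empty : ∀ {ℓ m} → ℓ ≤ m + + 0 → m ≤ ℓ - 1ℤ → ⊥
budget-empty {ℓ} {m} ℓ≤m+0 m≤ℓ-1 =
  ℤP.<⇒≱ (ℤP.i≤pred[j]⇒i<j (subst (m ≤_) (ℤP.+-comm ℓ (- 1ℤ)) m≤ℓ-1))
         (subst (ℓ ≤_) (ℤP.+-identityʳ m) ℓ≤m+0)

budget-enough : ∀ {ℓ m} → m ≤ ℓ → ℓ ≤ m + + ∣ ℓ - m ∣
budget-enough {ℓ} {m} m≤ℓ =
  ℤP.≤-reflexive (sym (trans (cong (λ j → m + j) (ℤP.0≤i⇒+∣i∣≡i (ℤP.i≤j⇒0≤j-i m≤ℓ))) (cancel m ℓ)))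
  where
  cancel : ∀ m ℓ → m + (ℓ - m) ≡ ℓ
  cancel = solve-∀

swap-admissible : ∀ {k m x} e b a → level e ≡ level b → Admissible k m (level a) x →
                  Admissible k m (level (swapA e b a)) (swapS e b x)
swap-admissible {m = m} {x} e b a le≡lb adm =
  subst (λ ℓ → Admissible _ m ℓ (swapS e b x)) (sym (swapA-level a le≡lb)) record
    { wf = wf-swapS le≡lb wf ; budget = budget ; m≤ℓ = m≤ℓ
    ; m≤x = subst (m ≤_) (sym (minlev-swapS le≡lb x)) m≤x }
  where open Admissible adm

atm-level : ∀ {ℓ n} → IsSet ℓ (atm n) → ℓ ≡ level n
atm-level wf-atm = refl

lam-level : ∀ {ℓ a' X} → IsSet ℓ (lam a' X) → level a' ≡ ℓ - 1ℤ
lam-level (wf-lam la'≡ℓ-1 _) = la'≡ℓ-1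

lam-body : ∀ {ℓ a' X} → IsSet ℓ (lam a' X) → IsPred X
lam-body (wf-lam _ X∈) = X∈

descend : ∀ {k m ℓ a' X y} → Admissible (suc k) m ℓ (lam a' X) → IsSet (ℓ - 1ℤ) y → m ≤ minlevS y →
          Admissible k m (level a') y
descend {k} {m} {a' = a'} {X} adm y∈ m≤y = record
  { wf = subst (λ ℓ' → IsSet ℓ' _) (sym (lam-level wf)) y∈
  ; budget = subst (_≤ m + + k) (sym (lam-level wf)) (budget-step {m = m} k budget)
  ; m≤ℓ = ℤP.≤-trans m≤x (ℤP.i⊓j≤i (level a') (minlevP X))
  ; m≤x = m≤y }
  where open Admissible adm

SubResultP : Atom → St → ℤ → Pred → Set
SubResultP a x m Z = Σ Pred λ R → SubP a x Z R × m ≤ minlevP R × IsPred R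

SubResultS : Atom → St → ℤ → ℤ → St → Set
SubResultS a x m k z = Σ St λ r → SubS a x z r × m ≤ minlevS r × IsSet k r

swap-result : ∀ {a x m Z} e b → level e ≡ level b →
              SubResultP (swapA e b a) (swapS e b x) m Z → SubResultP a x m (swapP e b Z)
swap-result {a} {x} {m} e b le≡lb (R , d , m≤R , R∈) =
  swapP e b R
  , subst₂ (λ a' x' → SubP a' x' _ _) (swapA-involutive e b a) (swapS-involutive e b x) (swapSubP e b le≡lb d)
  , subst (m ≤_) (sym (minlev-swapP le≡lb R)) m≤R
  , wf-swapP le≡lb R∈

rename-all : ∀ {e b X} → e #P X → level e ≡ level b → all b X ≈P all e (swapP e b X)
rename-all {e} {b} {X} e#X le≡lb =
  ≈-all e (sym le≡lb) le≡lb (fresh-all e#X) bound-fresh-all (≡⇒≈P (sym (swapP-self e (swapP e b X))))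

rename-lam : ∀ {e b X} → e #P X → level e ≡ level b → lam b X ≈S lam e (swapP e b X)
rename-lam {e} {b} {X} e#X le≡lb =
  ≈-lam e (sym le≡lb) le≡lb (fresh-lam e#X) bound-fresh-lam (≡⇒≈P (sym (swapP-self e (swapP e b X))))

-- The minlev of a conjunction includes 0, the value of the empty conjunction.
minlevPs≤0 : ∀ Xs → minlevPs Xs ≤ 0ℤ
minlevPs≤0 [] = ℤP.≤-refl
minlevPs≤0 (X ∷ Xs) = ℤP.≤-trans (ℤP.i⊓j≤j (minlevP X) (minlevPs Xs)) (minlevPs≤0 Xs)

-- Binders are renamed to a fresh e by recursing on the original body with
-- the swapped parameters and transposing the result back (swap-result).

mutual
  existP : ∀ k {m a x Z} → Admissible k m (level a) x → IsPred Z → m ≤ minlevP Z → SubResultP a x m Z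
  existP k {m} adm (wf-and {Xs} ws) m≤Z =
    let (Rs , ds , m≤Rs , Rs∈) = existPs k adm ws m≤Z (ℤP.≤-trans m≤Z (minlevPs≤0 Xs))
    in and Rs , s-and ds , m≤Rs , wf-and Rs∈
  existP k adm (wf-neg w) m≤Z =
    let (R , d , m≤R , R∈) = existP k adm w m≤Z
    in neg R , s-neg d , m≤R , wf-neg R∈
  existP k {m} {a} {x} adm (wf-all {b} {X} w) m≤Z =
    let (R , d , m≤R , R∈) = swap-result e b refl (existP k (swap-admissible e b a refl adm) w (ℤP.i≤j⊓k⇒i≤k _ _ m≤Z))
    in all e R
       , s-α (≈S-refl x) (rename-all (fresh-#P _ os 1st) refl)
             (s-all (fresh-≢ _ os 3rd) (fresh-#S _ os 2nd) d) (≈P-refl _)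
       , ℤP.⊓-glb (ℤP.i≤j⊓k⇒i≤j _ _ m≤Z) m≤R , wf-all R∈
    where
    os : List Obj
    os = pred X ∷ set x ∷ atom a ∷ []
    e : Atom
    e = fresh (level b) os
  existP k {a = a} adm (wf-mem {y} {c} w) m≤Z with c ≟A a
  ... | no c≢a =
    let (y' , d , m≤y' , y'∈) = existS k adm w (ℤP.i≤j⊓k⇒i≤j _ _ m≤Z)
    in mem y' c , s-mem c≢a d , ℤP.⊓-glb m≤y' (ℤP.i≤j⊓k⇒i≤k _ _ m≤Z) , wf-mem y'∈
  ... | yes refl = existMem k _ adm w (ℤP.i≤j⊓k⇒i≤j _ _ m≤Z)

  existPs : ∀ k {m a x Xs} → Admissible k m (level a) x → All IsPred Xs → m ≤ minlevPs Xs → m ≤ 0ℤ →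
            Σ (List Pred) λ Rs → Pointwise (SubP a x) Xs Rs × m ≤ minlevPs Rs × All IsPred Rs
  existPs k adm [] _ m≤0 = [] , [] , m≤0 , []
  existPs k adm (w ∷ ws) m≤Xs m≤0 =
    let (R , d , m≤R , R∈) = existP k adm w (ℤP.i≤j⊓k⇒i≤j _ _ m≤Xs)
        (Rs , ds , m≤Rs , Rs∈) = existPs k adm ws (ℤP.i≤j⊓k⇒i≤k _ _ m≤Xs) m≤0
    in R ∷ Rs , d ∷ ds , ℤP.⊓-glb m≤R m≤Rs , R∈ ∷ Rs∈

  existMem : ∀ k {m a y} x → Admissible k m (level a) x → IsSet (level a - 1ℤ) y → m ≤ minlevS y →
             SubResultP a x m (mem y a)
  existMem k (atm n) adm w m≤y =
    let (y' , d , m≤y' , y'∈) = existS k adm w m≤y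
    in mem y' n , s-mem-atm refl d , ℤP.⊓-glb m≤y' m≤x
       , wf-mem (subst (λ ℓ → IsSet (ℓ - 1ℤ) y') (atm-level wf) y'∈)
    where open Admissible adm
  existMem zero {m} (lam a' X) adm w m≤y =
    ⊥-elim (budget-empty budget (subst (m ≤_) (lam-level wf) (ℤP.i≤j⊓k⇒i≤j _ _ m≤x)))
    where open Admissible adm
  existMem (suc k) {m} {a} {y} (lam a' X) adm w m≤y =
    let (y' , dy , m≤y' , y'∈) = existS (suc k) adm w m≤y
        os : List Obj
        os = pred X ∷ set y ∷ set y' ∷ atom a ∷ []
        e : Atom
        e = fresh (level a') os
        x≈ : lam a' X ≈S lam e (swapP e a' X)
        x≈ = rename-lam (fresh-#P _ os 1st) refl
        (R , dX , m≤R , R∈) = existP k (descend adm y'∈ m≤y') (wf-swapP refl (lam-body wf))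
                                (subst (m ≤_) (sym (minlev-swapP refl X)) (ℤP.i≤j⊓k⇒i≤k _ _ m≤x))
    in R , s-α x≈ (≈P-refl _)
             (s-mem-lam refl (fresh-≢ _ os 4th) (fresh-#S _ os 2nd) (fresh-#S _ os 3rd)
                (s-α (≈S-sym x≈) (≈S-refl y) dy (≈S-refl y')) dX)
             (≈P-refl R)
       , m≤R , R∈
    where open Admissible adm

  existS : ∀ k {m a x j z} → Admissible k m (level a) x → IsSet j z → m ≤ minlevS z → SubResultS a x m j z
  existS k {a = a} adm (wf-atm {c}) m≤c with c ≟A a
  ... | yes refl = _ , s-atm-a , Admissible.m≤x adm , Admissible.wf adm
  ... | no c≢a = atm c , s-atm-b c≢a , m≤c , wf-atm
  existS k {m} {a} {x} adm (wf-lam {a = c} {X} lc≡ w) m≤z =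
    let (R , d , m≤R , R∈) = swap-result e c refl (existP k (swap-admissible e c a refl adm) w (ℤP.i≤j⊓k⇒i≤k _ _ m≤z))
    in lam e R
       , s-α (≈S-refl x) (rename-lam (fresh-#P _ os 1st) refl)
             (s-lam (fresh-≢ _ os 3rd) (fresh-#S _ os 2nd) d) (≈S-refl _)
       , ℤP.⊓-glb (ℤP.i≤j⊓k⇒i≤j _ _ m≤z) m≤R , wf-lam lc≡ R∈
    where
    os : List Obj
    os = pred X ∷ set x ∷ atom a ∷ []
    e : Atom
    e = fresh (level c) os

unique-resultP : ∀ {a x Z R R'} → SubP a x Z R → SubP a x Z R' → R' ≈P R
unique-resultP {x = x} {Z} d d' = uniqueP d' d _ _ ℕP.≤-refl ℕP.≤-refl (≈S-refl x) (≈P-refl Z)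

unique-resultS : ∀ {a x z r r'} → SubS a x z r → SubS a x z r' → r' ≈S r
unique-resultS {x = x} {z} d d' = uniqueS d' d _ _ ℕP.≤-refl ℕP.≤-refl (≈S-refl x) (≈S-refl z)

initial-admissible : ∀ {m a x} → IsSet (level a) x → m ≤ level a ⊓ minlevS x →
                     Admissible ∣ level a - m ∣ m (level a) x
initial-admissible x∈ m≤ = record
  { wf = x∈
  ; budget = budget-enough (ℤP.i≤j⊓k⇒i≤j _ _ m≤)
  ; m≤ℓ = ℤP.i≤j⊓k⇒i≤j _ _ m≤
  ; m≤x = ℤP.i≤j⊓k⇒i≤k _ _ m≤ }

proposition4p6 : (i : ℤ) (a : Atom) (x : St) → level a ≡ i → IsSet i x →
    ((Z : Pred) → IsPred Z →
      ∃[ R ] (SubP a x Z R × ((R' : Pred) → SubP a x Z R' → R' ≈P R)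
              × (minlevP Z ⊓ (level a ⊓ minlevS x)) ≤ minlevP R × IsPred R))
  × ((k : ℤ) (z : St) → IsSet k z →
      ∃[ r ] (SubS a x z r × ((r' : St) → SubS a x z r' → r' ≈S r)
              × (minlevS z ⊓ (level a ⊓ minlevS x)) ≤ minlevS r × IsSet k r))
proposition4p6 .(level a) a x refl x∈ = forPredicates , forSets
  where
  forPredicates : (Z : Pred) → IsPred Z →
    ∃[ R ] (SubP a x Z R × ((R' : Pred) → SubP a x Z R' → R' ≈P R)
            × (minlevP Z ⊓ (level a ⊓ minlevS x)) ≤ minlevP R × IsPred R)
  forPredicates Z Z∈ =
    let bound = ℤP.i⊓j≤j (minlevP Z) (level a ⊓ minlevS x)
        (R , d , m≤R , R∈) = existP _ (initial-admissible {a = a} x∈ bound) Z∈ (ℤP.i⊓j≤i (minlevP Z) _)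
    in R , d , (λ R' d' → unique-resultP d d') , m≤R , R∈

  forSets : (k : ℤ) (z : St) → IsSet k z →
    ∃[ r ] (SubS a x z r × ((r' : St) → SubS a x z r' → r' ≈S r)
            × (minlevS z ⊓ (level a ⊓ minlevS x)) ≤ minlevS r × IsSet k r)
  forSets k z z∈ =
    let bound = ℤP.i⊓j≤j (minlevS z) (level a ⊓ minlevS x)
        (r , d , m≤r , r∈) = existS _ (initial-admissible {a = a} x∈ bound) z∈ (ℤP.i⊓j≤i (minlevS z) _)
    in r , d , (λ r' d' → unique-resultS d d') , m≤r , r∈
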